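{- Let $E$ be a dark minimal ceer, and let $R$ be an arbitrary equivalence relation on $\omega$ such that $R$ has infinitely many equivalence classes and $R\supseteq E$. Then $R$ is minimal.
   Context: All equivalence relations have domain $\omega$. A ceer is a computably enumerable equivalence relation on $\omega$. For equivalence relations $R,S$, $R\leq_c S$ (computable reducibility) means there is a computable function $f$ with $xRy \Leftrightarrow f(x) S f(y)$ for all $x,y$; $R\equiv_c S$ means $R\leq_c S$ and $S\leq_c R$. $\mathrm{Id}$ denotes the identity relation on $\omega$, and for $n\geq 1$, $\mathrm{Id}_n$ is the relation $x\,\mathrm{Id}_n\,y \Leftrightarrow n\mid(x-y)$. A ceer is dark if it is $\leq_c$-incomparable with $\mathrm{Id}$. An equivalence relation $R$ is minimal if $R$ has infinitely many classes and for every equivalence relation $E'$, $E'\leq_c R$ implies $E'\equiv_c R$ or $E'\equiv_c\mathrm{Id}_n$ for some $n\geq 1$. -}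

module Defs where

open import Level using (0ℓ)
open import Data.Nat using (ℕ; zero; suc; _<_; _≤_; ∣_-_∣)
open import Data.Nat.Divisibility using (_∣_)
open import Data.Fin using (Fin)
open import Data.Vec using (Vec; []; _∷_; lookup)
open import Data.Product using (Σ; ∃; _×_; _,_)
open import Data.Sum using (_⊎_)
open import Relation.Nullary using (¬_)
open import Relation.Binary.Core using (Rel)
open import Relation.Binary.Structures using (IsEquivalence)
open import Relation.Binary.PropositionalEquality using (_≡_)
open import Function.Bundles using (_⇔_)

data Code : ℕ → Set where
  zer  : ∀ {n} → Code n
  succ : Code 1
  proj : ∀ {n} → Fin n → Code n
  comp : ∀ {m n} → Code m → Vec (Code n) m → Code n
  prec : ∀ {n} → Code n → Code (suc (suc n)) → Code (suc n)
  mu   : ∀ {n} → Code (suc n) → Code n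

mutual
  data Eval : ∀ {n} → Code n → Vec ℕ n → ℕ → Set where
    ev-zer  : ∀ {n} {xs : Vec ℕ n} → Eval zer xs 0
    ev-succ : ∀ {x} → Eval succ (x ∷ []) (suc x)
    ev-proj : ∀ {n} {i : Fin n} {xs} → Eval (proj i) xs (lookup xs i)
    ev-comp : ∀ {m n} {f : Code m} {gs : Vec (Code n) m} {xs ys y} →
              EvalAll gs xs ys → Eval f ys y → Eval (comp f gs) xs y
    ev-prec-z : ∀ {n} {g : Code n} {h} {xs y} →
              Eval g xs y → Eval (prec g h) (0 ∷ xs) y
    ev-prec-s : ∀ {n} {g : Code n} {h} {k xs r y} →
              Eval (prec g h) (k ∷ xs) r → Eval h (k ∷ r ∷ xs) y →
              Eval (prec g h) (suc k ∷ xs) y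
    ev-mu   : ∀ {n} {f : Code (suc n)} {xs y} →
              Eval f (y ∷ xs) 0 →
              (∀ z → z < y → ∃ λ k → Eval f (z ∷ xs) (suc k)) →
              Eval (mu f) xs y

  data EvalAll : ∀ {m n} → Vec (Code n) m → Vec ℕ n → Vec ℕ m → Set where
    []  : ∀ {n} {xs : Vec ℕ n} → EvalAll [] xs []
    _∷_ : ∀ {m n} {g : Code n} {gs : Vec (Code n) m} {xs y ys} →
          Eval g xs y → EvalAll gs xs ys → EvalAll (g ∷ gs) xs (y ∷ ys)

Computable₁ : (ℕ → ℕ) → Set
Computable₁ f = Σ (Code 1) λ c → ∀ x → Eval c (x ∷ []) (f x)

Computable₃ : (ℕ → ℕ → ℕ → ℕ) → Set
Computable₃ g = Σ (Code 3) λ c → ∀ x y s → Eval c (x ∷ y ∷ s ∷ []) (g x y s)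

IsCE : Rel ℕ 0ℓ → Set
IsCE R = Σ (ℕ → ℕ → ℕ → ℕ) λ g → Computable₃ g ×
           (∀ x y → (R x y ⇔ (∃ λ s → g x y s ≡ 0)))

Ceer : Rel ℕ 0ℓ → Set
Ceer R = IsEquivalence R × IsCE R

_≤c_ : Rel ℕ 0ℓ → Rel ℕ 0ℓ → Set
R ≤c S = Σ (ℕ → ℕ) λ f → Computable₁ f × (∀ x y → (R x y ⇔ S (f x) (f y)))

_≡c_ : Rel ℕ 0ℓ → Rel ℕ 0ℓ → Set
R ≡c S = (R ≤c S) × (S ≤c R)

Id : Rel ℕ 0ℓ
Id = _≡_

Idₙ : ℕ → Rel ℕ 0ℓ
Idₙ n x y = n ∣ ∣ x - y ∣

Dark : Rel ℕ 0ℓ → Set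
Dark E = ¬ (Id ≤c E) × ¬ (E ≤c Id)

InfinitelyManyClasses : Rel ℕ 0ℓ → Set
InfinitelyManyClasses R =
  ∀ n → Σ (Fin n → ℕ) λ v → ∀ i j → R (v i) (v j) → i ≡ j

Minimal : Rel ℕ 0ℓ → Set₁
Minimal R = InfinitelyManyClasses R ×
  (∀ (E' : Rel ℕ 0ℓ) → IsEquivalence E' → E' ≤c R →
     (E' ≡c R) ⊎ (∃ λ n → (1 ≤ n) × (E' ≡c Idₙ n)))

-- Let f reduce E′ to R. The pullback E on f reduces to E, so by minimality of E
-- it is ≡c E or ≡c Idₙ n. In the second case E′ contains the pullback of Idₙ n
-- along a computable map, so the classes of E′ are finitely many and computably
-- indexed by residues mod n, whence E′ ≡c Idₘ. In the first case f ∘ h is a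
-- self-reduction of E for some h; as E is dark, its range meets every E-class
-- (otherwise an orbit of f ∘ h would reduce Id to E), so searching the enumeration
-- of E computes g with E (f (g x)) x. As E ⊆ R, g then reduces R to E′.
module Submission where

open import Defs
open import Level using (0ℓ)
open import Axiom.ExcludedMiddle using (ExcludedMiddle)
open import Data.Empty using (⊥-elim)
import Data.Fin as Fin
open Fin using (Fin; toℕ; zero; suc; #_)
open import Data.Fin.Properties
  using (toℕ-injective; toℕ-fromℕ<; toℕ<n) renaming (suc-injective to Fin-suc-injective)
open import Data.Nat
  using (ℕ; zero; suc; pred; _+_; _*_; _∸_; _≤_; _<_; z≤n; s≤s; s≤s⁻¹; ∣_-_∣; NonZero; >-nonZero)
open import Data.Nat.Properties
open import Data.Nat.DivMod
open import Data.Nat.Divisibility using (_∣_; divides)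
open import Data.Nat.GeneralisedArithmetic using (fold)
open import Data.Product using (Σ; ∃; ∃₂; _×_; _,_; proj₁; proj₂)
open import Data.Sum using (_⊎_; inj₁; inj₂; [_,_]′)
open import Data.Vec using (Vec; []; _∷_; lookup; map)
open import Data.Vec.Relation.Unary.All using (All; []; _∷_)
open import Function.Base using (id; _∘_; _on_; flip)
open import Function.Bundles using (_⇔_; mk⇔; Equivalence)
open import Function.Properties.Equivalence using () renaming (sym to ⇔-sym; trans to ⇔-trans)
open import Relation.Binary.Core using (Rel; _⇒_)
open import Relation.Binary.Structures using (IsEquivalence)
open import Relation.Binary.PropositionalEquality
import Relation.Binary.Construct.On as On
open import Relation.Nullary using (¬_; Dec; yes; no)

open Equivalence using (to; from)

Fn : ℕ → Set
Fn n = Vec ℕ n → ℕ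

Computable : ∀ {n} → Fn n → Set
Computable {n} F = Σ (Code n) λ c → ∀ xs → Eval c xs (F xs)

unary : (ℕ → ℕ) → Fn 1
unary f (x ∷ []) = f x

binary : (ℕ → ℕ → ℕ) → Fn 2
binary f (x ∷ y ∷ []) = f x y

ternary : (ℕ → ℕ → ℕ → ℕ) → Fn 3
ternary f (x ∷ y ∷ z ∷ []) = f x y z

computable-cong : ∀ {n} {F G : Fn n} → Computable F → (∀ xs → F xs ≡ G xs) → Computable G
computable-cong (c , ev) F≗G = c , λ xs → subst (Eval c xs) (F≗G xs) (ev xs)

unary-computable : ∀ {f} → Computable₁ f → Computable (unary f)
unary-computable (c , ev) = c , λ { (x ∷ []) → ev x }

ternary-computable : ∀ {f} → Computable₃ f → Computable (ternary f)
ternary-computable (c , ev) = c , λ { (x ∷ y ∷ s ∷ []) → ev x y s }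

computable₁ : ∀ {F : Fn 1} → Computable F → Computable₁ (λ x → F (x ∷ []))
computable₁ (c , ev) = c , λ x → ev (x ∷ [])

computable₃ : ∀ {F : Fn 3} → Computable F → Computable₃ (λ x y s → F (x ∷ y ∷ s ∷ []))
computable₃ (c , ev) = c , λ x y s → ev (x ∷ y ∷ s ∷ [])

computable₁-cong : ∀ {f g} → Computable₁ f → (∀ x → f x ≡ g x) → Computable₁ g
computable₁-cong (c , ev) f≗g = c , λ x → subst (Eval c (x ∷ [])) (f≗g x) (ev x)

proj-computable : ∀ {n} (i : Fin n) → Computable (λ xs → lookup xs i)
proj-computable i = proj i , λ _ → ev-proj

suc-computable : Computable (unary suc)
suc-computable = succ , λ { (x ∷ []) → ev-succ }

compose : ∀ {m n} {F : Fn m} {Gs : Vec (Fn n) m} → Computable F → All Computable Gs →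
          Computable (λ xs → F (map (λ G → G xs) Gs))
compose {n = n} (c , ev) cGs = comp c (codes cGs) , λ xs → ev-comp (evalAll cGs xs) (ev _)
  where
  codes : ∀ {k} {Hs : Vec (Fn n) k} → All Computable Hs → Vec (Code n) k
  codes [] = []
  codes ((d , _) ∷ cHs) = d ∷ codes cHs
  evalAll : ∀ {k} {Hs : Vec (Fn n) k} (cHs : All Computable Hs) xs →
            EvalAll (codes cHs) xs (map (λ H → H xs) Hs)
  evalAll [] xs = []
  evalAll ((_ , evH) ∷ cHs) xs = evH xs ∷ evalAll cHs xs

∘-computable₁ : ∀ {f g} → Computable₁ f → Computable₁ g → Computable₁ (f ∘ g)
∘-computable₁ cf cg = computable₁ (compose (unary-computable cf) (unary-computable cg ∷ []))

const-computable : ∀ {n} k → Computable {n} (λ _ → k)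
const-computable zero = zer , λ _ → ev-zer
const-computable (suc k) = compose suc-computable (const-computable k ∷ [])

primRec-computable : ∀ {n} {g : Fn n} {h : Fn (suc (suc n))} {F : Fn (suc n)} →
  Computable g → Computable h →
  (∀ xs → F (zero ∷ xs) ≡ g xs) →
  (∀ k xs → F (suc k ∷ xs) ≡ h (k ∷ F (k ∷ xs) ∷ xs)) →
  Computable F
primRec-computable {F = F} (cg , evg) (ch , evh) base step = prec cg ch , ev
  where
  ev : ∀ xs → Eval (prec cg ch) xs (F xs)
  ev (zero ∷ xs) = subst (Eval _ _) (sym (base xs)) (ev-prec-z (evg xs))
  ev (suc k ∷ xs) = subst (Eval _ _) (sym (step k xs)) (ev-prec-s (ev (k ∷ xs)) (evh _))

least-zero : (p : ℕ → ℕ) → ∀ y → p y ≡ 0 → Σ ℕ λ μ → p μ ≡ 0 × (∀ z → z < μ → p z ≢ 0)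
least-zero p zero p0≡0 = 0 , p0≡0 , λ _ ()
least-zero p (suc y) py≡0 with p 0 ≟ 0
... | yes p0≡0 = 0 , p0≡0 , λ _ ()
... | no p0≢0 =
  let μ , pμ≡0 , below = least-zero (p ∘ suc) y py≡0
  in suc μ , pμ≡0 , λ { zero _ → p0≢0 ; (suc z) z<μ → below z (s≤s⁻¹ z<μ) }

record Minimiser {n} (F : Fn (suc n)) : Set where
  field
    μ : Fn n
    μ-computable : Computable μ
    μ-zero : ∀ xs → F (μ xs ∷ xs) ≡ 0

minimise : ∀ {n} {F : Fn (suc n)} → Computable F → (∀ xs → ∃ λ y → F (y ∷ xs) ≡ 0) →
  Minimiser F
minimise {n} {F} (c , ev) hasZero = record
  { μ = μ
  ; μ-computable = mu c , λ xs → ev-mu (subst (Eval c _) (μ-zero xs) (ev _)) (positiveBelow xs)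
  ; μ-zero = μ-zero }
  where
  least : ∀ xs → Σ ℕ λ μ → F (μ ∷ xs) ≡ 0 × (∀ z → z < μ → F (z ∷ xs) ≢ 0)
  least xs = least-zero (λ y → F (y ∷ xs)) (proj₁ (hasZero xs)) (proj₂ (hasZero xs))
  μ : Fn n
  μ xs = proj₁ (least xs)
  μ-zero : ∀ xs → F (μ xs ∷ xs) ≡ 0
  μ-zero xs = proj₁ (proj₂ (least xs))
  positiveBelow : ∀ xs z → z < μ xs → ∃ λ k → Eval c (z ∷ xs) (suc k)
  positiveBelow xs z z<μ with F (z ∷ xs) | ev (z ∷ xs) | proj₂ (proj₂ (least xs)) z z<μ
  ... | zero  | _   | Fz≢0 = ⊥-elim (Fz≢0 refl)
  ... | suc k | evz | _    = k , evz

ifZero : ℕ → ℕ → ℕ → ℕ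
ifZero zero    a b = a
ifZero (suc _) a b = b

ifZero-computable : Computable (ternary ifZero)
ifZero-computable = primRec-computable (proj-computable (# 0)) (proj-computable (# 3))
  (λ { (a ∷ b ∷ []) → refl }) (λ { _ (a ∷ b ∷ []) → refl })

pred-computable : Computable (unary pred)
pred-computable = primRec-computable (const-computable 0) (proj-computable (# 0))
  (λ { [] → refl }) (λ { _ [] → refl })

∸-computable : Computable (binary (flip _∸_))
∸-computable = primRec-computable (proj-computable (# 0))
  (compose pred-computable (proj-computable (# 1) ∷ []))
  (λ { (x ∷ []) → refl }) (λ { y (x ∷ []) → sym (pred[m∸n]≡m∸[1+n] x y) })

fold-computable : ∀ a {k} → Computable₁ k → Computable₁ (fold a k)
fold-computable a {k} k-computable = computable₁ {F = unary (fold a k)}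
  (primRec-computable (const-computable a)
    (compose (unary-computable k-computable) (proj-computable (# 1) ∷ []))
    (λ { [] → refl }) (λ { _ [] → refl }))

[1+m]%n≡[1+m%n]%n : ∀ m n .{{_ : NonZero n}} → suc m % n ≡ suc (m % n) % n
[1+m]%n≡[1+m%n]%n m n = begin
  suc m % n                     ≡⟨ %-congˡ (cong suc (m≡m%n+[m/n]*n m n)) ⟩
  (suc (m % n) + m / n * n) % n ≡⟨ [m+kn]%n≡m%n (suc (m % n)) (m / n) n ⟩
  suc (m % n) % n               ∎
  where open ≡-Reasoning

[1+m]%n≡ifZero : ∀ m n .{{_ : NonZero n}} → suc m % n ≡ ifZero (n ∸ suc (m % n)) 0 (suc (m % n))
[1+m]%n≡ifZero m n with n ∸ suc (m % n) in eq
... | zero = begin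
  suc m % n       ≡⟨ [1+m]%n≡[1+m%n]%n m n ⟩
  suc (m % n) % n ≡⟨ cong (_% n) (≤-antisym (m%n<n m n) (m∸n≡0⇒m≤n eq)) ⟩
  n % n           ≡⟨ n%n≡0 n ⟩
  0               ∎
  where open ≡-Reasoning
... | suc _ = trans ([1+m]%n≡[1+m%n]%n m n)
                    (m<n⇒m%n≡m (m∸n≢0⇒n<m λ eq′ → 0≢1+n (trans (sym eq′) eq)))

%-computable : ∀ n .{{_ : NonZero n}} → Computable₁ (_% n)
%-computable n@(suc _) = computable₁ {F = unary (_% n)}
  (primRec-computable (const-computable 0) wrap (λ { [] → refl }) (λ { m [] → [1+m]%n≡ifZero m n }))
  where
  successor : Computable {2} (λ xs → suc (lookup xs (# 1)))
  successor = compose suc-computable (proj-computable (# 1) ∷ [])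
  wrap : Computable {2} (λ xs → ifZero (n ∸ suc (lookup xs (# 1))) 0 (suc (lookup xs (# 1))))
  wrap = compose ifZero-computable
    (compose ∸-computable (successor ∷ const-computable n ∷ [])
     ∷ const-computable 0 ∷ successor ∷ [])

extend : ∀ {n} → (Fin n → ℕ) → ℕ → ℕ
extend {zero}  t _       = 0
extend {suc n} t zero    = t zero
extend {suc n} t (suc r) = extend (t ∘ Fin.suc) r

extend-toℕ : ∀ {n} (t : Fin n → ℕ) i → extend t (toℕ i) ≡ t i
extend-toℕ t zero    = refl
extend-toℕ t (suc i) = extend-toℕ (t ∘ Fin.suc) i

extend-computable : ∀ {n} (t : Fin n → ℕ) → Computable₁ (extend t)
extend-computable {zero}  t = computable₁ {F = unary (extend t)}
  (computable-cong (const-computable 0) λ { (_ ∷ []) → refl })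
extend-computable {suc n} t = computable₁ {F = unary (extend t)}
  (primRec-computable (const-computable (t zero))
    (compose (unary-computable (extend-computable (t ∘ Fin.suc))) (proj-computable (# 0) ∷ []))
    (λ { [] → refl }) (λ { _ [] → refl }))

finite-computable : ∀ {n} .{{_ : NonZero n}} (t : Fin n → ℕ) → Computable₁ (λ u → t (u mod n))
finite-computable {n} t = computable₁-cong (∘-computable₁ (extend-computable t) (%-computable n))
  λ u → trans (cong (extend t) (sym (toℕ-fromℕ< (m%n<n u n)))) (extend-toℕ t (u mod n))

zeroBelow : (ℕ → ℕ) → ℕ → ℕ
zeroBelow p zero    = 1
zeroBelow p (suc b) = ifZero (p b) 0 (zeroBelow p b)

zeroBelow-sound : ∀ p b → zeroBelow p b ≡ 0 → ∃ λ z → z < b × p z ≡ 0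
zeroBelow-sound p (suc b) below≡0 with p b in pb≡
... | zero  = b , ≤-refl , pb≡
... | suc _ = let z , z<b , pz≡0 = zeroBelow-sound p b below≡0 in z , m<n⇒m<1+n z<b , pz≡0

zeroBelow-complete : ∀ p {z b} → z < b → p z ≡ 0 → zeroBelow p b ≡ 0
zeroBelow-complete p {z} {suc b} z<1+b pz≡0 with p b in pb≡ | m≤n⇒m<n∨m≡n (s≤s⁻¹ z<1+b)
... | zero  | _         = refl
... | suc _ | inj₁ z<b  = zeroBelow-complete p z<b pz≡0
... | suc _ | inj₂ refl = ⊥-elim (0≢1+n (trans (sym pz≡0) pb≡))

zeroBelow-computable : {P : Fn 3} → Computable P →
  Computable {3} (λ { (b ∷ w ∷ x ∷ []) → zeroBelow (λ z → P (z ∷ w ∷ x ∷ [])) b })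
zeroBelow-computable P-computable = primRec-computable (const-computable 1)
  (compose ifZero-computable
    (compose P-computable (proj-computable (# 0) ∷ proj-computable (# 2) ∷ proj-computable (# 3) ∷ [])
     ∷ const-computable 0 ∷ proj-computable (# 1) ∷ []))
  (λ { (w ∷ x ∷ []) → refl }) (λ { _ (w ∷ x ∷ []) → refl })

IsCE-on : ∀ {P : Rel ℕ 0ℓ} {f} → IsCE P → Computable₁ f → IsCE (λ z x → P (f z) x)
IsCE-on {f = f} (G , G-computable , P⇔G) f-computable =
  (λ z x s → G (f z) x s) ,
  computable₃ (compose (ternary-computable G-computable)
    (compose (unary-computable f-computable) (proj-computable (# 0) ∷ [])
     ∷ proj-computable (# 1) ∷ proj-computable (# 2) ∷ [])) ,
  λ z x → P⇔G (f z) x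

-- The pairs (z , s) are enumerated along the diagonals w = z + s, so that a single
-- unbounded search over w suffices.
diagonal-bound : ∀ {G : ℕ → ℕ → ℕ → ℕ} → Computable₃ G → (∀ x → ∃₂ λ z s → G z x s ≡ 0) →
  Σ (ℕ → ℕ) λ W → Computable₁ W × ∀ x → ∃ λ z → G z x (W x ∸ z) ≡ 0
diagonal-bound {G} G-computable hasZero =
  W , computable₁ W.μ-computable ,
  λ x → let z , _ , G≡0 = zeroBelow-sound (λ z → G z x (W x ∸ z)) (suc (W x)) (W.μ-zero (x ∷ []))
        in z , G≡0
  where
  diagonal : Computable {3}
    (λ xs → G (lookup xs (# 0)) (lookup xs (# 2)) (lookup xs (# 1) ∸ lookup xs (# 0)))
  diagonal = compose (ternary-computable G-computable)
    (proj-computable (# 0) ∷ proj-computable (# 2)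
     ∷ compose ∸-computable (proj-computable (# 0) ∷ proj-computable (# 1) ∷ []) ∷ [])
  D : Fn 2
  D (w ∷ x ∷ []) = zeroBelow (λ z → G z x (w ∸ z)) (suc w)
  D-computable : Computable D
  D-computable = computable-cong
    (compose (zeroBelow-computable diagonal)
      (compose suc-computable (proj-computable (# 0) ∷ [])
       ∷ proj-computable (# 0) ∷ proj-computable (# 1) ∷ []))
    λ { (w ∷ x ∷ []) → refl }
  D-hasZero : ∀ xs → ∃ λ w → D (w ∷ xs) ≡ 0
  D-hasZero (x ∷ []) =
    let z , s , G≡0 = hasZero x
    in z + s , zeroBelow-complete (λ z′ → G z′ x (z + s ∸ z′)) (s≤s (m≤m+n z s))
                 (subst (λ t → G z x t ≡ 0) (sym (m+n∸m≡n z s)) G≡0)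
  module W = Minimiser (minimise D-computable D-hasZero)
  W : ℕ → ℕ
  W x = W.μ (x ∷ [])

ce-uniformisation : ∀ {P : Rel ℕ 0ℓ} → IsCE P → (∀ x → ∃ λ z → P z x) →
  Σ (ℕ → ℕ) λ g → Computable₁ g × ∀ x → P (g x) x
ce-uniformisation {P} (G , G-computable , P⇔G) total =
  g , computable₁ Z.μ-computable , λ x → from (P⇔G _ x) (_ , Z.μ-zero (x ∷ []))
  where
  bound : Σ (ℕ → ℕ) λ W → Computable₁ W × ∀ x → ∃ λ z → G z x (W x ∸ z) ≡ 0
  bound = diagonal-bound G-computable λ x → let z , Pzx = total x in z , to (P⇔G z x) Pzx
  W : ℕ → ℕ
  W = proj₁ bound
  W-computable : Computable₁ W
  W-computable = proj₁ (proj₂ bound)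
  Q : Fn 2
  Q (z ∷ x ∷ []) = G z x (W x ∸ z)
  Q-computable : Computable Q
  Q-computable = computable-cong
    (compose (ternary-computable G-computable)
      (proj-computable (# 0) ∷ proj-computable (# 1)
       ∷ compose ∸-computable
           (proj-computable (# 0)
            ∷ compose (unary-computable W-computable) (proj-computable (# 1) ∷ []) ∷ [])
       ∷ []))
    λ { (z ∷ x ∷ []) → refl }
  Q-hasZero : ∀ xs → ∃ λ z → Q (z ∷ xs) ≡ 0
  Q-hasZero (x ∷ []) = proj₂ (proj₂ bound) x
  module Z = Minimiser (minimise Q-computable Q-hasZero)
  g : ℕ → ℕ
  g x = Z.μ (x ∷ [])

Idₙ⇒%≡ : ∀ n .{{_ : NonZero n}} u v → Idₙ n u v → u % n ≡ v % n
Idₙ⇒%≡ n u v n∣∣u-v∣ =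
  [ (λ u≤v → ordered u≤v n∣∣u-v∣)
  , (λ v≤u → sym (ordered v≤u (subst (n ∣_) (∣-∣-comm u v) n∣∣u-v∣))) ]′ (≤-total u v)
  where
  ordered : ∀ {u v} → u ≤ v → n ∣ ∣ u - v ∣ → u % n ≡ v % n
  ordered {u} {v} u≤v (divides q ∣u-v∣≡qn) = begin
    u % n               ≡⟨ [m+kn]%n≡m%n u q n ⟨
    (u + q * n) % n     ≡⟨ cong (λ d → (u + d) % n) ∣u-v∣≡qn ⟨
    (u + ∣ u - v ∣) % n ≡⟨ cong (λ d → (u + d) % n) (m≤n⇒∣m-n∣≡n∸m u≤v) ⟩
    (u + (v ∸ u)) % n   ≡⟨ cong (_% n) (m+[n∸m]≡n u≤v) ⟩
    v % n               ∎
    where open ≡-Reasoning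

%≡⇒Idₙ : ∀ n .{{_ : NonZero n}} u v → u % n ≡ v % n → Idₙ n u v
%≡⇒Idₙ n u v u%n≡v%n = divides ∣ u / n - v / n ∣ (begin
  ∣ u - v ∣
    ≡⟨ cong₂ ∣_-_∣ (m≡m%n+[m/n]*n u n) (m≡m%n+[m/n]*n v n) ⟩
  ∣ u % n + u / n * n - v % n + v / n * n ∣
    ≡⟨ cong (λ r → ∣ u % n + u / n * n - r + v / n * n ∣) u%n≡v%n ⟨
  ∣ u % n + u / n * n - u % n + v / n * n ∣
    ≡⟨ ∣m+n-m+o∣≡∣n-o∣ (u % n) _ _ ⟩
  ∣ u / n * n - v / n * n ∣
    ≡⟨ *-distribʳ-∣-∣ n (u / n) (v / n) ⟨
  ∣ u / n - v / n ∣ * n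
    ∎)
  where open ≡-Reasoning

Idₙ⇔mod≡ : ∀ n .{{_ : NonZero n}} u v → Idₙ n u v ⇔ u mod n ≡ v mod n
Idₙ⇔mod≡ n u v = mk⇔
  (λ n∣∣u-v∣ →
    toℕ-injective (trans (toℕ-mod u) (trans (Idₙ⇒%≡ n u v n∣∣u-v∣) (sym (toℕ-mod v)))))
  (λ eq → %≡⇒Idₙ n u v (trans (sym (toℕ-mod u)) (trans (cong toℕ eq) (toℕ-mod v))))
  where
  toℕ-mod : ∀ x → toℕ (x mod n) ≡ x % n
  toℕ-mod x = toℕ-fromℕ< (m%n<n x n)

Idₙ-toℕ : ∀ {n} .{{_ : NonZero n}} (i j : Fin n) → Idₙ n (toℕ i) (toℕ j) ⇔ i ≡ j
Idₙ-toℕ {n} i j = mk⇔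
  (λ n∣ → toℕ-injective (trans (sym (small i)) (trans (Idₙ⇒%≡ n _ _ n∣) (small j))))
  (λ { refl → %≡⇒Idₙ n (toℕ i) (toℕ i) refl })
  where
  small : ∀ k → toℕ k % n ≡ toℕ k
  small k = m<n⇒m%n≡m (toℕ<n k)

record Quotient {n} (S : Rel (Fin n) 0ℓ) : Set where
  field
    size : ℕ
    class : Fin n → Fin size
    rep : Fin size → Fin n
    class-rep : ∀ k → class (rep k) ≡ k
    related⇔sameClass : ∀ i j → S i j ⇔ class i ≡ class j

  rep-related⇔ : ∀ j k → S (rep j) (rep k) ⇔ j ≡ k
  rep-related⇔ j k = ⇔-trans (related⇔sameClass (rep j) (rep k))
    (mk⇔ (λ eq → trans (sym (class-rep j)) (trans eq (class-rep k))) (cong class ∘ cong rep))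

finite-quotient : ExcludedMiddle 0ℓ → ∀ {n} {S : Rel (Fin n) 0ℓ} → IsEquivalence S → Quotient S
finite-quotient lem {zero} _ = record
  { size = 0 ; class = λ () ; rep = λ () ; class-rep = λ () ; related⇔sameClass = λ () }
finite-quotient lem {suc n} {S} S-equiv = adjoin lem
  where
  module S = IsEquivalence S-equiv
  module Q = Quotient (finite-quotient lem (On.isEquivalence Fin.suc S-equiv))
  adjoin : Dec (∃ λ i → S zero (suc i)) → Quotient S
  adjoin (yes (i , 0~i)) = record
    { size = Q.size ; class = class ; rep = Fin.suc ∘ Q.rep ; class-rep = Q.class-rep
    ; related⇔sameClass = related }
    where
    class : Fin (suc n) → Fin Q.size
    class zero    = Q.class i
    class (suc j) = Q.class j
    related : ∀ j k → S j k ⇔ class j ≡ class k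
    related zero    zero    = mk⇔ (λ _ → refl) (λ _ → S.refl)
    related zero    (suc k) =
      ⇔-trans (mk⇔ (S.trans (S.sym 0~i)) (S.trans 0~i)) (Q.related⇔sameClass i k)
    related (suc j) zero    =
      ⇔-trans (mk⇔ (λ j~0 → S.trans j~0 0~i) (λ j~i → S.trans j~i (S.sym 0~i))) (Q.related⇔sameClass j i)
    related (suc j) (suc k) = Q.related⇔sameClass j k
  adjoin (no isolated) = record
    { size = suc Q.size ; class = class ; rep = rep ; class-rep = class-rep
    ; related⇔sameClass = related }
    where
    class : Fin (suc n) → Fin (suc Q.size)
    class zero    = zero
    class (suc j) = suc (Q.class j)
    rep : Fin (suc Q.size) → Fin (suc n)
    rep zero    = zero
    rep (suc k) = suc (Q.rep k)
    class-rep : ∀ k → class (rep k) ≡ k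
    class-rep zero    = refl
    class-rep (suc k) = cong suc (Q.class-rep k)
    related : ∀ j k → S j k ⇔ class j ≡ class k
    related zero    zero    = mk⇔ (λ _ → refl) (λ _ → S.refl)
    related zero    (suc k) = mk⇔ (λ 0~k → ⊥-elim (isolated (k , 0~k))) λ ()
    related (suc j) zero    = mk⇔ (λ j~0 → ⊥-elim (isolated (j , S.sym j~0))) λ ()
    related (suc j) (suc k) = ⇔-trans (Q.related⇔sameClass j k) (mk⇔ (cong suc) Fin-suc-injective)

section-on-range : ExcludedMiddle 0ℓ → {B : Set} (f : ℕ → B) →
  Σ (B → ℕ) λ s → ∀ x → f (s (f x)) ≡ f x
section-on-range lem f = (λ b → choose {b} lem) , λ x → choose-spec lem (x , refl)
  where
  choose : ∀ {b} → Dec (∃ λ x → f x ≡ b) → ℕ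
  choose (yes (x , _)) = x
  choose (no _)        = 0
  choose-spec : ∀ {b} (d : Dec (∃ λ x → f x ≡ b)) → ∃ (λ x → f x ≡ b) → f (choose d) ≡ b
  choose-spec (yes (_ , fx≡b)) _  = fx≡b
  choose-spec (no none)        hit = ⊥-elim (none hit)

-- Every x is X-related to the chosen point w (ρ x) of its residue, so X is the
-- pullback along ρ of an equivalence relation on the finite set Fin n.
Idₙ-coarsening : ExcludedMiddle 0ℓ → ∀ {X : Rel ℕ 0ℓ} → IsEquivalence X →
  ∀ {n c} → 1 ≤ n → Computable₁ c → (∀ x y → Idₙ n (c x) (c y) → X x y) →
  ∃ λ m → 1 ≤ m × X ≡c Idₙ m
Idₙ-coarsening lem {X} X-equiv {n} {c} 1≤n c-computable coarse = Q.size , 1≤size , X≤Idₘ , Idₘ≤X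
  where
  instance
    n≢0 : NonZero n
    n≢0 = >-nonZero 1≤n
  module X = IsEquivalence X-equiv
  ρ : ℕ → Fin n
  ρ x = c x mod n
  w : Fin n → ℕ
  w = proj₁ (section-on-range lem ρ)
  x~wρx : ∀ x → X x (w (ρ x))
  x~wρx x = coarse x _ (from (Idₙ⇔mod≡ n _ _) (sym (proj₂ (section-on-range lem ρ) x)))
  module Q = Quotient (finite-quotient lem (On.isEquivalence w X-equiv))
  X⇔sameClass : ∀ x y → X x y ⇔ Q.class (ρ x) ≡ Q.class (ρ y)
  X⇔sameClass x y = ⇔-trans
    (mk⇔ (λ x~y → X.trans (X.sym (x~wρx x)) (X.trans x~y (x~wρx y)))
         (λ wx~wy → X.trans (x~wρx x) (X.trans wx~wy (X.sym (x~wρx y)))))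
    (Q.related⇔sameClass (ρ x) (ρ y))
  1≤size : 1 ≤ Q.size
  1≤size = ≤-trans (s≤s z≤n) (toℕ<n (Q.class (ρ 0)))
  instance
    size≢0 : NonZero Q.size
    size≢0 = >-nonZero 1≤size
  X≤Idₘ : X ≤c Idₙ Q.size
  X≤Idₘ = (λ x → toℕ (Q.class (c x mod n))) ,
    ∘-computable₁ (finite-computable (toℕ ∘ Q.class)) c-computable ,
    λ x y → ⇔-trans (X⇔sameClass x y) (⇔-sym (Idₙ-toℕ _ _))
  Idₘ≤X : Idₙ Q.size ≤c X
  Idₘ≤X = (λ u → w (Q.rep (u mod Q.size))) , finite-computable (w ∘ Q.rep) ,
    λ u v → ⇔-trans (Idₙ⇔mod≡ Q.size u v) (⇔-sym (Q.rep-related⇔ _ _))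

orbit-injective : ∀ {E : Rel ℕ 0ℓ} → IsEquivalence E → (k≤ : E ≤c E) → ∀ a →
  ¬ (∃ λ z → E (proj₁ k≤ z) a) →
  ∀ x y → E (fold a (proj₁ k≤) x) (fold a (proj₁ k≤) y) → x ≡ y
orbit-injective {E} E-equiv (k , _ , k-red) a miss = injective
  where
  injective : ∀ x y → E (fold a k x) (fold a k y) → x ≡ y
  injective zero    zero    _ = refl
  injective zero    (suc y) e = ⊥-elim (miss (fold a k y , IsEquivalence.sym E-equiv e))
  injective (suc x) zero    e = ⊥-elim (miss (fold a k x , e))
  injective (suc x) (suc y) e = cong suc (injective x y (from (k-red _ _) e))

self-reduction-meets-every-class : ExcludedMiddle 0ℓ → ∀ {E : Rel ℕ 0ℓ} → IsEquivalence E →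
  ¬ (Id ≤c E) → (k≤ : E ≤c E) → ∀ a → ∃ λ z → E (proj₁ k≤ z) a
self-reduction-meets-every-class lem {E} E-equiv Id≰E k≤@(k , k-computable , _) a
  with lem {∃ λ z → E (k z) a}
... | yes hit = hit
... | no miss = ⊥-elim (Id≰E (fold a k , fold-computable a k-computable ,
  λ x y → mk⇔ (λ { refl → IsEquivalence.refl E-equiv }) (orbit-injective E-equiv k≤ a miss x y)))

right-inverse⇒≤c : ∀ {E′ R : Rel ℕ 0ℓ} → IsEquivalence R → (f≤ : E′ ≤c R) →
  ∀ {g} → Computable₁ g → (∀ x → R (proj₁ f≤ (g x)) x) → R ≤c E′
right-inverse⇒≤c R-equiv (f , _ , f-red) {g} g-computable fg~id = g , g-computable , λ x y → mk⇔
  (λ x~y → from (f-red _ _) (R.trans (fg~id x) (R.trans x~y (R.sym (fg~id y)))))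
  (λ gx~gy → R.trans (R.sym (fg~id x)) (R.trans (to (f-red _ _) gx~gy) (fg~id y)))
  where module R = IsEquivalence R-equiv

E≤c-pullback⇒R≤cE′ : ExcludedMiddle 0ℓ → ∀ {E R E′ : Rel ℕ 0ℓ} → Ceer E → ¬ (Id ≤c E) →
  IsEquivalence R → E ⇒ R → (f≤ : E′ ≤c R) → E ≤c (E on proj₁ f≤) → R ≤c E′
E≤c-pullback⇒R≤cE′ lem {E} (E-equiv , E-ce) Id≰E R-equiv E⊆R f≤@(f , f-computable , _)
  (h , h-computable , h-red) =
  let g , g-computable , fg~id = ce-uniformisation (IsCE-on E-ce f-computable) meets
  in right-inverse⇒≤c R-equiv f≤ g-computable (λ x → E⊆R (fg~id x))
  where
  fh≤ : E ≤c E
  fh≤ = f ∘ h , ∘-computable₁ f-computable h-computable , h-red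
  meets : ∀ a → ∃ λ z → E (f z) a
  meets a = let z , fhz~a = self-reduction-meets-every-class lem E-equiv Id≰E fh≤ a in h z , fhz~a

proposition2 : ExcludedMiddle 0ℓ →
    (E R : Rel ℕ 0ℓ) → Ceer E → Dark E → Minimal E →
    IsEquivalence R → InfinitelyManyClasses R → E ⇒ R → Minimal R
proposition2 lem E R E-ceer@(E-equiv , _) (Id≰E , _) (_ , E-minimal) R-equiv R-infinite E⊆R =
  R-infinite , classify
  where
  classify : ∀ E′ → IsEquivalence E′ → E′ ≤c R → (E′ ≡c R) ⊎ (∃ λ m → (1 ≤ m) × (E′ ≡c Idₙ m))
  classify E′ E′-equiv f≤@(f , f-computable , f-red)
    with E-minimal (E on f) (On.isEquivalence f E-equiv) (f , f-computable , λ _ _ → mk⇔ id id)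
  ... | inj₁ (_ , E≤E∘f) = inj₁ (f≤ , E≤c-pullback⇒R≤cE′ lem E-ceer Id≰E R-equiv E⊆R f≤ E≤E∘f)
  ... | inj₂ (n , 1≤n , (g , g-computable , g-red) , _) =
    inj₂ (Idₙ-coarsening lem E′-equiv 1≤n g-computable
           λ x y → from (f-red x y) ∘ E⊆R ∘ from (g-red x y))
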